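{- For every integer $n>3$, \[ \sum_{x=\lfloor n/3\rfloor+1}^{\lfloor n/2\rfloor} A(n-x,x) \;=\; 1+\sum_{x=\lfloor n/3\rfloor+1}^{\lfloor (n-2)/2\rfloor} A(n-2-x,x). \]
   Context: An ascending composition of a positive integer $n$ is a sequence of positive integers $\langle a_1,\dots,a_k\rangle$ with $a_1+\dots+a_k=n$ and $a_1\le\dots\le a_k$. For positive integers $m\le n$, $A(n,m)$ denotes the number of ascending compositions of $n$ with first part $a_1\ge m$. Empty sums are $0$. -}

module Defs where

open import Data.Nat using (ℕ; zero; suc; _+_; _∸_; _≤_; _≤?_; _/_)
open import Data.List using (List; []; _∷_; map; concatMap; upTo; length; filter)
open import Data.Nat.ListAction using (sum)
open import Data.Nat using (_≟_)
open import Data.List.Relation.Unary.All using (All)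
open import Data.List.Relation.Unary.All using (all?)
open import Data.List.Relation.Unary.Linked using (Linked)
open import Data.List.Relation.Unary.Linked.Properties using ()
open import Data.Product using (_×_)
open import Relation.Binary.PropositionalEquality using (_≡_)
open import Relation.Nullary using (Dec; yes; no)
open import Relation.Nullary.Decidable using (_×-dec_)
open import Relation.Unary using (Pred)

IsComposition : ℕ → List ℕ → Set
IsComposition n as = All (λ a → 1 ≤ a) as × sum as ≡ n

IsAscending : List ℕ → Set
IsAscending = Linked _≤_

-- First part ≥ m (vacuous for the empty list; only relevant for n = 0).
FirstPartAtLeast : ℕ → List ℕ → Set
FirstPartAtLeast m [] = Data.Unit.⊤
  where import Data.Unit
FirstPartAtLeast m (a ∷ _) = m ≤ a

-- Enumeration of all lists of positive integers summing to n
-- (fuel k ≥ n ensures completeness): first part a ∈ {1..n}, rest a composition of n ∸ a.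
compositionsF : ℕ → ℕ → List (List ℕ)
compositionsF _ zero = [] ∷ []
compositionsF zero (suc _) = []
compositionsF (suc k) (suc n) =
  concatMap (λ i → map (suc i ∷_) (compositionsF k (n ∸ i))) (upTo (suc n))

compositions : ℕ → List (List ℕ)
compositions n = compositionsF n n

firstPart? : (m : ℕ) → (as : List ℕ) → Dec (FirstPartAtLeast m as)
firstPart? m [] = yes _
firstPart? m (a ∷ _) = m ≤? a

ascending? : (as : List ℕ) → Dec (IsAscending as)
ascending? = Data.List.Relation.Unary.Linked.linked? _≤?_
  where import Data.List.Relation.Unary.Linked

composition? : (n : ℕ) → (as : List ℕ) → Dec (IsComposition n as)
composition? n as = all? (λ a → 1 ≤? a) as ×-dec (sum as ≟ n)

A : ℕ → ℕ → ℕ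
A n m = length (filter (λ as → composition? n as ×-dec ascending? as ×-dec firstPart? m as) (compositions n))

-- Σ_{x = lo}^{hi} f x  (empty, i.e. 0, when hi < lo).
sumFromTo : ℕ → ℕ → (ℕ → ℕ) → ℕ
sumFromTo lo hi f = sum (map (λ i → f (lo + i)) (upTo (suc hi ∸ lo)))

module Submission where

open import Defs
open import Data.Nat using (ℕ; _+_; _∸_; _<_; _/_)
open import Relation.Binary.PropositionalEquality using (_≡_)

open import Data.Nat using (zero; suc; pred; _*_; _%_; _≤_; z≤n; s≤s; s≤s⁻¹; NonZero)
open import Data.Nat.Properties
open import Data.Nat.DivMod using (m≡m%n+[m/n]*n; m%n<n; m/n*n≤m; /-monoˡ-≤; [m∸n]/n≡m/n∸1; m<n*o⇒m/o<n)
open import Data.Nat.ListAction using (sum)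
open import Data.List using (List; []; _∷_; [_]; _++_; map; concatMap; upTo; length; filter)
open import Data.List.Properties using (∷-injectiveˡ; upTo-∷ʳ; concatMap-++; ++-identityʳ; filter-++; filter-none; filter-accept; length-upTo)
open import Data.List.Relation.Unary.All as All using (All; []; _∷_; universal)
open import Data.List.Relation.Unary.All.Properties using (concat⁺; map⁺; applyUpTo⁺₁; all-upTo)
open import Data.List.Relation.Unary.Linked using (_∷_; [-])
open import Data.Product using (_×_; _,_)
open import Data.Empty using (⊥-elim)
open import Relation.Nullary using (¬_; Dec; contradiction)
open import Relation.Nullary.Decidable using (_×-dec_)
open import Relation.Binary.PropositionalEquality using (refl; sym; trans; cong; cong₂; subst; module ≡-Reasoning)

-- If x ≤ m < 2x, an ascending composition of m with first
-- part ≥ x cannot have two parts (they would already sum to ≥ 2x > m), so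
-- ⟨m⟩ is the only one and A(m, x) = 1.  For ⌊n/3⌋ < x ≤ ⌊n/2⌋ the number
-- m = n − x lies in that window, and likewise m = n − 2 − x for
-- x ≤ ⌊(n−2)/2⌋.  Hence both sums of the theorem just count the integers of
-- their summation ranges, and these ranges differ by exactly one element
-- because ⌊(n−2)/2⌋ = ⌊n/2⌋ − 1 and (for n > 3) ⌊n/3⌋ < ⌊n/2⌋.

IsAscComp : ℕ → ℕ → List ℕ → Set
IsAscComp m x as = IsComposition m as × IsAscending as × FirstPartAtLeast x as

ascComp? : (m x : ℕ) (as : List ℕ) → Dec (IsAscComp m x as)
ascComp? m x as = composition? m as ×-dec ascending? as ×-dec firstPart? x as

two-parts-bound : ∀ {x a b} rest → x ≤ a → IsAscending (a ∷ b ∷ rest) →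
                  x + x ≤ sum (a ∷ b ∷ rest)
two-parts-bound {b = b} rest x≤a (a≤b ∷ _) =
  +-mono-≤ x≤a (≤-trans (≤-trans x≤a a≤b) (m≤m+n b (sum rest)))

window-unique : ∀ {m x} as → 0 < m → m < x + x → IsAscComp m x as → as ≡ [ m ]
window-unique []              0<m _     ((_ , sum≡m) , _)         = ⊥-elim (<-irrefl sum≡m 0<m)
window-unique (a ∷ [])        _   _     ((_ , sum≡m) , _)         =
  cong [_] (trans (sym (+-identityʳ a)) sum≡m)
window-unique (a ∷ b ∷ rest)  _   m<2x  ((_ , sum≡m) , asc , x≤a) =
  contradiction (≤-trans (two-parts-bound rest x≤a asc) (≤-reflexive sum≡m)) (<⇒≱ m<2x)

singleton-qualifies : ∀ {m x} → 1 ≤ m → x ≤ m → IsAscComp m x [ m ]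
singleton-qualifies {m} 1≤m x≤m = ((1≤m ∷ []) , +-identityʳ m) , [-] , x≤m

withFirst : ℕ → ℕ → List (List ℕ)
withFirst n i = map (suc i ∷_) (compositionsF n (n ∸ i))

compositions-split : ∀ n →
  compositions (suc n) ≡ concatMap (withFirst n) (upTo n) ++ [ [ suc n ] ]
compositions-split n = begin
  concatMap (withFirst n) (upTo (suc n))
    ≡⟨ cong (concatMap (withFirst n)) (sym (upTo-∷ʳ n)) ⟩
  concatMap (withFirst n) (upTo n ++ [ n ])
    ≡⟨ concatMap-++ (withFirst n) (upTo n) [ n ] ⟩
  concatMap (withFirst n) (upTo n) ++ withFirst n n ++ []
    ≡⟨ cong (λ l → concatMap (withFirst n) (upTo n) ++ l) (++-identityʳ (withFirst n n)) ⟩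
  concatMap (withFirst n) (upTo n) ++ map (suc n ∷_) (compositionsF n (n ∸ n))
    ≡⟨ cong (λ k → concatMap (withFirst n) (upTo n) ++ map (suc n ∷_) (compositionsF n k)) (n∸n≡0 n) ⟩
  concatMap (withFirst n) (upTo n) ++ [ [ suc n ] ]
    ∎
  where open ≡-Reasoning

withFirst-not-singleton : ∀ n → All (λ as → ¬ as ≡ [ suc n ]) (concatMap (withFirst n) (upTo n))
withFirst-not-singleton n =
  concat⁺ (map⁺ (applyUpTo⁺₁ (λ i → i) n λ i<n →
    map⁺ (universal (λ _ eq → <-irrefl (suc-injective (∷-injectiveˡ eq)) i<n) _)))

A-window : ∀ m x → 1 ≤ x → x ≤ m → m < x + x → A m x ≡ 1
A-window zero    x 1≤x x≤0 _    = contradiction (≤-trans 1≤x x≤0) (<-irrefl refl)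
A-window (suc n) x _   x≤m m<2x = begin
  length (filter P (compositions (suc n)))
    ≡⟨ cong (λ l → length (filter P l)) (compositions-split n) ⟩
  length (filter P (shorter ++ [ [ suc n ] ]))
    ≡⟨ cong length (filter-++ P shorter [ [ suc n ] ]) ⟩
  length (filter P shorter ++ filter P [ [ suc n ] ])
    ≡⟨ cong₂ (λ u v → length (u ++ v)) (filter-none P rejected) (filter-accept P accepted) ⟩
  1
    ∎
  where
  open ≡-Reasoning
  P = ascComp? (suc n) x
  shorter = concatMap (withFirst n) (upTo n)
  rejected : All (λ as → ¬ IsAscComp (suc n) x as) shorter
  rejected = All.map (λ {as} ≢m q → ≢m (window-unique as (s≤s z≤n) m<2x q))
                     (withFirst-not-singleton n)
  accepted : IsAscComp (suc n) x [ suc n ]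
  accepted = singleton-qualifies (s≤s z≤n) x≤m

A-after-first-part : ∀ m x → m < x * 3 → x * 2 ≤ m → A (m ∸ x) x ≡ 1
A-after-first-part m x m<3x 2x≤m = A-window (m ∸ x) x (positive x m<3x) x≤m∸x m∸x<2x
  where
  positive : ∀ y → m < y * 3 → 1 ≤ y
  positive zero    m<0 = contradiction m<0 n≮0
  positive (suc _) _   = s≤s z≤n
  x*2≡x+x : x * 2 ≡ x + x
  x*2≡x+x = trans (*-suc x 1) (cong (x +_) (*-identityʳ x))
  x*3≡x+[x+x] : x * 3 ≡ x + (x + x)
  x*3≡x+[x+x] = trans (*-suc x 2) (cong (x +_) x*2≡x+x)
  x+x≤m : x + x ≤ m
  x+x≤m = subst (_≤ m) x*2≡x+x 2x≤m
  x≤m : x ≤ m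
  x≤m = ≤-trans (m≤m+n x x) x+x≤m
  x≤m∸x : x ≤ m ∸ x
  x≤m∸x = m+n≤o⇒m≤o∸n x x+x≤m
  m∸x<2x : m ∸ x < x + x
  m∸x<2x = subst (m ∸ x <_) (m+n∸m≡n x (x + x))
             (∸-monoˡ-< (subst (m <_) x*3≡x+[x+x] m<3x) x≤m)

sum-ones : ∀ (g : ℕ → ℕ) {l} → All (λ i → g i ≡ 1) l → sum (map g l) ≡ length l
sum-ones g []         = refl
sum-ones g (gi≡1 ∷ p) = cong₂ _+_ gi≡1 (sum-ones g p)

offset-in-range : ∀ lo hi i → i < suc hi ∸ lo → lo + i ≤ hi
offset-in-range zero    hi       i i<    = s≤s⁻¹ i<
offset-in-range (suc l) zero     i i<    = contradiction (subst (i <_) (0∸n≡0 l) i<) n≮0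
offset-in-range (suc l) (suc hi) i i<    = s≤s (offset-in-range l hi i i<)

sumFromTo-ones : ∀ lo hi (f : ℕ → ℕ) → (∀ x → lo ≤ x → x ≤ hi → f x ≡ 1) →
                 sumFromTo lo hi f ≡ suc hi ∸ lo
sumFromTo-ones lo hi f f≡1 =
  trans (sum-ones (λ i → f (lo + i)) (All.map in-range (all-upTo (suc hi ∸ lo))))
        (length-upTo (suc hi ∸ lo))
  where
  in-range : ∀ {i} → i < suc hi ∸ lo → f (lo + i) ≡ 1
  in-range {i} i< = f≡1 (lo + i) (m≤m+n lo i) (offset-in-range lo hi i i<)

range-drop-last : ∀ {lo hi} → 0 < lo → lo ≤ hi → suc hi ∸ lo ≡ suc (suc (pred hi) ∸ lo)
range-drop-last {hi = zero}  (s≤s z≤n) ()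
range-drop-last {hi = suc _} _        lo≤hi = +-∸-assoc 1 lo≤hi

below-floor : ∀ n d .{{_ : NonZero d}} {x} → x ≤ n / d → x * d ≤ n
below-floor n d x≤ = ≤-trans (*-monoˡ-≤ d x≤) (m/n*n≤m n d)

above-floor : ∀ n d .{{_ : NonZero d}} {x} → n / d < x → n < x * d
above-floor n d {x} n/d<x = begin-strict
  n                    ≡⟨ m≡m%n+[m/n]*n n d ⟩
  n % d + (n / d) * d  <⟨ +-monoˡ-< ((n / d) * d) (m%n<n n d) ⟩
  suc (n / d) * d      ≤⟨ *-monoˡ-≤ d n/d<x ⟩
  x * d                ∎
  where open ≤-Reasoning

-- For n > 3 the summation range of the theorem is nonempty: ⌊n/3⌋ < ⌊n/2⌋,
-- because n < (⌊n/2⌋ + 1)·2 ≤ ⌊n/2⌋·3 once ⌊n/2⌋ ≥ 2.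
third-below-half : ∀ n → 3 < n → n / 3 < n / 2
third-below-half n 3<n = m<n*o⇒m/o<n (begin-strict
  n                  <⟨ above-floor n 2 (n<1+n (n / 2)) ⟩
  2 + (n / 2) * 2    ≤⟨ +-monoˡ-≤ ((n / 2) * 2) (/-monoˡ-≤ 2 3<n) ⟩
  n / 2 + (n / 2) * 2 ≡⟨ *-suc (n / 2) 2 ⟨
  (n / 2) * 3        ∎)
  where open ≤-Reasoning

lemma4p4 : (n : ℕ) → 3 < n →
    sumFromTo (n / 3 + 1) (n / 2) (λ x → A (n ∸ x) x)
    ≡ 1 + sumFromTo (n / 3 + 1) ((n ∸ 2) / 2) (λ x → A (n ∸ 2 ∸ x) x)
lemma4p4 n 3<n = begin
  sumFromTo lo (n / 2) (λ x → A (n ∸ x) x)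
    ≡⟨ sumFromTo-ones lo (n / 2) _ (λ x lo≤x x≤h →
         A-after-first-part n x (n<3x lo≤x) (below-floor n 2 x≤h)) ⟩
  suc (n / 2) ∸ lo
    ≡⟨ range-drop-last (m≤n+m 1 (n / 3)) lo≤n/2 ⟩
  suc (suc (pred (n / 2)) ∸ lo)
    ≡⟨ cong (λ h → suc (suc h ∸ lo)) ([m∸n]/n≡m/n∸1 n 2) ⟨
  suc (suc ((n ∸ 2) / 2) ∸ lo)
    ≡⟨ cong suc (sumFromTo-ones lo ((n ∸ 2) / 2) _ (λ x lo≤x x≤h →
         A-after-first-part (n ∸ 2) x (≤-<-trans (m∸n≤m n 2) (n<3x lo≤x)) (below-floor (n ∸ 2) 2 x≤h))) ⟨
  1 + sumFromTo lo ((n ∸ 2) / 2) (λ x → A (n ∸ 2 ∸ x) x)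
    ∎
  where
  open ≡-Reasoning
  lo = n / 3 + 1
  lo≡suc : lo ≡ suc (n / 3)
  lo≡suc = +-comm (n / 3) 1
  n<3x : ∀ {x} → lo ≤ x → n < x * 3
  n<3x {x} lo≤x = above-floor n 3 (subst (_≤ x) lo≡suc lo≤x)
  lo≤n/2 : lo ≤ n / 2
  lo≤n/2 = subst (_≤ n / 2) (sym lo≡suc) (third-below-half n 3<n)
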